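{- Let $(A,\mapsto)$ be a PARS and $D_1,D_2\in\mathrm{Dist}(A)$. If $D_1$ is terminal and $D_1\twoheadrightarrow^{*}D_2$, then $D_1\approx D_2$ and $D_2$ is terminal.
   Context: For a set $A$, $\mathrm{Dist}(A)$ is the set of finite lists of pairs $(p,a)$ with $p\in\mathbb{R}^+$ and $a\in A$; $[\,]$ is the empty list, $::$ is cons, $++$ is concatenation. The weight of a list is the sum of its $p$'s; $\mathrm{Dist}_1(A)$ is the set of lists of weight $1$; $\alpha[(p_i,a_i)]_i=[(\alpha p_i,a_i)]_i$. A PARS is a pair $(A,\mapsto)$ with $\mapsto\subseteq A\times\mathrm{Dist}_1(A)$. An element $a$ is terminal if there is no $E$ with $a\mapsto E$; a distribution is terminal if all elements occurring in it are terminal. The relation $\sim$ on $\mathrm{Dist}(A)$ is the smallest relation containing all instances of $[(p,a),(q,b)]\sim[(q,b),(p,a)]$ (Flip), $[(p,a),(q,a)]\sim[(p+q,a)]$ (Join), $[(p+q,a)]\sim[(p,a),(q,a)]$ (Split), and such that $D\sim D'$ implies $E_1++D++E_2\sim E_1++D'++E_2$ for all $E_1,E_2$; $\approx$ is the reflexive-transitive closure of $\sim$. Parallel evolution $\to_P$ is defined inductively by: $[\,]\to_P[\,]$; if $ds\to_P ds'$ then $(p,a)::ds\to_P(p,a)::ds'$; if $a\mapsto E$ and $ds\to_P ds'$ then $(p,a)::ds\to_P pE++ds'$. Define $\twoheadrightarrow\;=\;\to_P\cup\approx$ on $\mathrm{Dist}(A)$, and $\twoheadrightarrow^*$ its reflexive-transitive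 closure. -}

module Defs where

open import Level using (Level; _⊔_; suc)
open import Data.List using (List; []; _∷_; _++_; map; foldr)
open import Data.List.Membership.Propositional using (_∈_)
open import Data.Product using (_×_; _,_; proj₁; proj₂; ∃-syntax)
open import Relation.Binary.PropositionalEquality using (_≡_)
open import Relation.Nullary using (¬_)
open import Relation.Binary.Construct.Closure.ReflexiveTransitive using (Star)

-- The weights p ∈ ℝ⁺ are
-- abstracted into a structure: a carrier (the positive reals) with
-- addition, multiplication and a distinguished element 1.  The theorem is
-- stated for every such structure (ℝ⁺ being one instance).
record Weights (ℓ : Level) : Set (suc ℓ) where
  field
    W   : Set ℓ
    _⊕_ : W → W → W
    _⊛_ : W → W → W
    one : W

module _ {ℓw : Level} (Wt : Weights ℓw) where
  open Weights Wt

  Dist : ∀ {ℓ} → Set ℓ → Set (ℓw ⊔ ℓ)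
  Dist A = List (W × A)

  -- weight of a list: sum of the p's.  The empty list has no weight
  -- in ℝ⁺ (it is 0), so we say "has weight w" relationally.
  data HasWeight {ℓ} {A : Set ℓ} : Dist A → W → Set (ℓw ⊔ ℓ) where
    weight-one  : ∀ p a → HasWeight ((p , a) ∷ []) p
    weight-cons : ∀ p a ds w → HasWeight ds w → HasWeight ((p , a) ∷ ds) (p ⊕ w)

  Dist₁ : ∀ {ℓ} → Set ℓ → Set (ℓw ⊔ ℓ)
  Dist₁ A = ∃[ D ] HasWeight {A = A} D one

  scale : ∀ {ℓ} {A : Set ℓ} → W → Dist A → Dist A
  scale α = map (λ { (p , a) → (α ⊛ p , a) })

  record PARS (ℓ ℓ' : Level) : Set (suc (ℓw ⊔ ℓ ⊔ ℓ')) where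
    field
      A   : Set ℓ
      _↦_ : A → Dist A → Set ℓ'
      ↦-Dist₁ : ∀ {a E} → a ↦ E → HasWeight E one

  module _ {ℓ ℓ'} (R : PARS ℓ ℓ') where
    open PARS R

    Terminal : A → Set (ℓw ⊔ ℓ ⊔ ℓ')
    Terminal a = ∀ E → ¬ (a ↦ E)

    TerminalDist : Dist A → Set (ℓw ⊔ ℓ ⊔ ℓ')
    TerminalDist D = ∀ {p a} → (p , a) ∈ D → Terminal a

    data _∼_ : Dist A → Dist A → Set (ℓw ⊔ ℓ) where
      flip  : ∀ p a q b → ((p , a) ∷ (q , b) ∷ []) ∼ ((q , b) ∷ (p , a) ∷ [])
      join  : ∀ p q a → ((p , a) ∷ (q , a) ∷ []) ∼ (((p ⊕ q) , a) ∷ [])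
      split : ∀ p q a → (((p ⊕ q) , a) ∷ []) ∼ ((p , a) ∷ (q , a) ∷ [])
      ctx   : ∀ E₁ E₂ {D D'} → D ∼ D' → (E₁ ++ D ++ E₂) ∼ (E₁ ++ D' ++ E₂)

    _≈_ : Dist A → Dist A → Set (ℓw ⊔ ℓ)
    _≈_ = Star _∼_

    data _→P_ : Dist A → Dist A → Set (ℓw ⊔ ℓ ⊔ ℓ') where
      nil  : [] →P []
      keep : ∀ p a {ds ds'} → ds →P ds' → ((p , a) ∷ ds) →P ((p , a) ∷ ds')
      step : ∀ p a {E ds ds'} → a ↦ E → ds →P ds' → ((p , a) ∷ ds) →P (scale p E ++ ds')

    data _↠_ (D D' : Dist A) : Set (ℓw ⊔ ℓ ⊔ ℓ') where
      par : D →P D' → D ↠ D'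
      eqv : D ≈ D' → D ↠ D'

    _↠*_ : Dist A → Dist A → Set (ℓw ⊔ ℓ ⊔ ℓ')
    _↠*_ = Star _↠_

-- Rearrangement by ∼ only changes weights, never which elements occur, so it
-- preserves terminality; and a terminal distribution has no element that can
-- evolve, so parallel evolution can only leave it unchanged.  Along a ↠*
-- sequence from a terminal distribution every step is therefore a ≈-step.
module Submission where

open import Defs
open import Data.Product using (_×_; _,_; ∃-syntax)
open import Data.List using ([]; _∷_)
open import Data.List.Relation.Unary.Any using (here; there)
open import Data.List.Membership.Propositional using (_∈_)
open import Data.List.Membership.Propositional.Properties using (∈-++⁺ˡ; ∈-++⁺ʳ; ∈-++⁻)
open import Data.Sum using (inj₁; inj₂)
open import Data.Empty using (⊥-elim)
open import Relation.Binary.PropositionalEquality using (_≡_; refl)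
open import Relation.Binary.Construct.Closure.ReflexiveTransitive using (ε; _◅_; _◅◅_)

module _ {ℓw ℓ ℓ'} (Wt : Weights ℓw) (R : PARS Wt ℓ ℓ') where
  open Weights Wt
  open PARS R

  ∼-support : ∀ {D D'} → _∼_ Wt R D D' → ∀ {p a} → (p , a) ∈ D' → ∃[ q ] (q , a) ∈ D
  ∼-support (flip p a q b) (here refl)         = q , there (here refl)
  ∼-support (flip p a q b) (there (here refl)) = p , here refl
  ∼-support (join p q a)   (here refl)         = p , here refl
  ∼-support (split p q a)  (here refl)         = p ⊕ q , here refl
  ∼-support (split p q a)  (there (here refl)) = p ⊕ q , here refl
  ∼-support (ctx E₁ E₂ {D} {D'} s) m with ∈-++⁻ E₁ m
  ... | inj₁ m∈E₁ = _ , ∈-++⁺ˡ m∈E₁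
  ... | inj₂ m∈D'E₂ with ∈-++⁻ D' m∈D'E₂
  ...   | inj₂ m∈E₂ = _ , ∈-++⁺ʳ E₁ (∈-++⁺ʳ D m∈E₂)
  ...   | inj₁ m∈D' with ∼-support s m∈D'
  ...     | q , n∈D = q , ∈-++⁺ʳ E₁ (∈-++⁺ˡ n∈D)

  ∼-preserves-terminal : ∀ {D D'} → _∼_ Wt R D D' → TerminalDist Wt R D → TerminalDist Wt R D'
  ∼-preserves-terminal s t m with ∼-support s m
  ... | _ , n = t n

  ≈-preserves-terminal : ∀ {D D'} → _≈_ Wt R D D' → TerminalDist Wt R D → TerminalDist Wt R D'
  ≈-preserves-terminal ε        t = t
  ≈-preserves-terminal (s ◅ ss) t = ≈-preserves-terminal ss (∼-preserves-terminal s t)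

  →P-terminal-fixed : ∀ {D D'} → _→P_ Wt R D D' → TerminalDist Wt R D → D ≡ D'
  →P-terminal-fixed nil          t = refl
  →P-terminal-fixed (keep p a s) t with →P-terminal-fixed s (λ m → t (there m))
  ... | refl = refl
  →P-terminal-fixed (step p a a↦E s) t = ⊥-elim (t (here refl) _ a↦E)

  ↠*-terminal : ∀ {D₁ D₂} → TerminalDist Wt R D₁ → _↠*_ Wt R D₁ D₂
              → _≈_ Wt R D₁ D₂ × TerminalDist Wt R D₂
  ↠*-terminal t ε = ε , t
  ↠*-terminal t (par s ◅ ss) with →P-terminal-fixed s t
  ... | refl = ↠*-terminal t ss
  ↠*-terminal t (eqv e ◅ ss) with ↠*-terminal (≈-preserves-terminal e t) ss
  ... | e′ , t′ = e ◅◅ e′ , t′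

lemma3p6 : ∀ {ℓw ℓ ℓ'} (Wt : Weights ℓw) (R : PARS Wt ℓ ℓ')
    → (D₁ D₂ : Dist Wt (PARS.A R))
    → TerminalDist Wt R D₁
    → _↠*_ Wt R D₁ D₂
    → _≈_ Wt R D₁ D₂ × TerminalDist Wt R D₂
lemma3p6 Wt R D₁ D₂ = ↠*-terminal Wt R
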